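{- Let $[a,b]\subseteq[1,T]$ be a timerange, $Q$ a profile over $[a,b]$, and $h$ an integer. Let $S$ be a good multiset of resources that is an $h$-free SLRA cover for $Q$. Then at least one of the following holds: (1) the set of short resources in $S$ forms an $h$-free cover for $Q$; (2) (time-cut) there exist a timeslot $t^*$ with $a\le t^*\le b-1$ and a partition of $S$ into $S_1$ and $S_2$ such that $S_1$ is an $h$-free SLRA cover for $Q_1$ and $S_2$ is an $h$-free SLRA cover for $Q_2$, where $Q_1,Q_2$ are the restrictions of $Q$ to $[a,t^*]$ and $[t^*+1,b]$ respectively; (3) (interval-cut) there exists a long resource $i^*\in S$ such that the set of short resources in $S$ forms an $h$-free cover for both $Q_1$ and $Q_2$, where $Q_1,Q_2$ are the restrictions of $Q$ to $[a,s(i^*)-1]$ and $[e(i^*)+1,b]$ respectively.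
   Context: Setting (LSPC): timeslots $[1,T]$ with integral demands $d_t\ge0$; resources $i$ with interval $[s(i),e(i)]\subseteq[1,T]$, integer capacity $w(i)$, cost $c(i)$, each either short (interval is a single timeslot) or long. A resource is active at $t$ if $t$ lies in its interval. A profile over $[a,b]$ is a function $Q$ assigning an integer $Q(t)\le d_t$ to each $t\in[a,b]$. A multiset $S$ of resources is good if for each $t$ it contains at most one (copy of one) short resource active at $t$. For good $S$, $Q^{\mathrm{sh}}_S(t)$ is the capacity of the short resource of $S$ active at $t$ if one exists, else $0$; for a long resource $i$, $f_S(i)$ is the number of copies of $i$ in $S$. A good set $S$ of short resources is an $h$-free cover for a profile $Q$ over $[a,b]$ if $Q^{\mathrm{sh}}_S(t)\ge Q(t)-h$ for all $t\in[a,b]$ (for empty ranges this holds vacuously). A good multiset $S$ is an $h$-free SLRA cover for a profile $Q$ over $[a,b]$ if for every $t\in[a,b]$ with $Q(t)-Q^{\mathrm{sh}}_S(t)>h$ there exists a long resource $i\in S$ active at $t$ with $w(i)f_S(i)\ge Q(t)-Q^{\mathrm{sh}}_S(t)$. -}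

module Defs where

open import Data.Nat using (ℕ; zero; suc; _+_; _*_; _∸_; _≤_; _<_; _≤?_)
open import Data.Integer as ℤ using (ℤ; +_; _-_)
open import Data.Fin using (Fin; zero; suc)
open import Data.Bool using (Bool; true; false; _∧_; if_then_else_; not)
open import Data.Product using (_×_; Σ; ∃; _,_)
open import Relation.Nullary.Decidable using (⌊_⌋)
open import Relation.Binary.PropositionalEquality using (_≡_)

sumFin : (m : ℕ) → (Fin m → ℕ) → ℕ
sumFin zero    f = 0
sumFin (suc m) f = f zero + sumFin m (λ i → f (suc i))

-- An LSPC instance: timeslots [1,T], demands d_t, resources indexed by Fin m.
-- Each resource has an interval [s i, e i] ⊆ [1,T], integer capacity w i ≥ 0,
-- cost c i, and is either short (short i ≡ true, interval is a single timeslot)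
-- or long (short i ≡ false).
record Instance : Set where
  field
    T      : ℕ
    d      : ℕ → ℕ
    m      : ℕ
    s      : Fin m → ℕ
    e      : Fin m → ℕ
    w      : Fin m → ℕ
    c      : Fin m → ℕ
    short  : Fin m → Bool
    short-single : ∀ i → short i ≡ true → s i ≡ e i
    interval-ok  : ∀ i → 1 ≤ s i × s i ≤ e i × e i ≤ T

module _ (I : Instance) where
  open Instance I

  -- Multisets of resources: multiplicity functions.
  Multiset : Set
  Multiset = Fin m → ℕ

  Active : Fin m → ℕ → Set
  Active i t = s i ≤ t × t ≤ e i

  activeB : Fin m → ℕ → Bool
  activeB i t = ⌊ s i ≤? t ⌋ ∧ ⌊ t ≤? e i ⌋

  isLong : Fin m → Bool
  isLong i = not (short i)

  IsProfile : ℕ → ℕ → (ℕ → ℤ) → Set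
  IsProfile a b Q = ∀ t → a ≤ t → t ≤ b → Q t ℤ.≤ + d t

  shortCount : Multiset → ℕ → ℕ
  shortCount S t = sumFin m (λ i → if short i ∧ activeB i t then S i else 0)

  Good : Multiset → Set
  Good S = ∀ t → shortCount S t ≤ 1

  -- Q^sh_S(t): capacity of the short resource of S active at t, else 0
  -- (for good S the sum below has at most one non-zero term, with multiplicity 1).
  Qsh : Multiset → ℕ → ℕ
  Qsh S t = sumFin m (λ i → if short i ∧ activeB i t then S i * w i else 0)

  OnlyShort : Multiset → Set
  OnlyShort S = ∀ i → short i ≡ false → S i ≡ 0

  shortPart : Multiset → Multiset
  shortPart S i = if short i then S i else 0

  FreeCover : ℤ → ℕ → ℕ → (ℕ → ℤ) → Multiset → Set
  FreeCover h a b Q S =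
    OnlyShort S × Good S ×
    (∀ t → a ≤ t → t ≤ b → Q t - h ℤ.≤ + Qsh S t)

  SLRACover : ℤ → ℕ → ℕ → (ℕ → ℤ) → Multiset → Set
  SLRACover h a b Q S =
    Good S ×
    (∀ t → a ≤ t → t ≤ b → h ℤ.< Q t - + Qsh S t →
       Σ (Fin m) λ i → isLong i ≡ true × 1 ≤ S i × Active i t ×
         Q t - + Qsh S t ℤ.≤ + (w i * S i))

  Partition : Multiset → Multiset → Multiset → Set
  Partition S S1 S2 = ∀ i → S1 i + S2 i ≡ S i

module Submission where

-- Call a timeslot t uncovered by S when its deficit Q t - Qsh S t exceeds h.
-- If no slot of [a,b] is uncovered, the short part of S is an h-free cover
-- (outcome 1).  Otherwise let t₀ be the first uncovered slot and X a long
-- resource of S of maximum capacity w X · S X among the long resources of S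
-- active at t₀.  Let t be the last slot of [t₀, e X] at which X still has
-- maximum capacity among the active long resources of S.
--   * If no slot after t is uncovered, X is an interval cut: every slot
--     before s X ≤ t₀ and every slot after e X ≥ t is covered (outcome 3).
--   * Otherwise t is a time cut: S₁ keeps X and the resources ending by t,
--     S₂ keeps the rest.  Left of t, a strongest witness either ends by t or
--     is dominated by X; right of t, a strongest witness is never X (t was the
--     last slot where X is strongest), so it ends after t (outcome 2).

open import Defs
open import Data.Nat using (ℕ; zero; suc; _+_; _*_; _∸_; _≤_; _<_; z≤n; s≤s; _≤?_; >-nonZero)
import Data.Nat.Properties as ℕP
open import Data.Integer using (ℤ; +_; _-_)
import Data.Integer as ℤ
import Data.Integer.Properties as ℤP
open import Data.Integer.Tactic.RingSolver using (solve-∀)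
open import Data.Fin using (Fin)
import Data.Fin as Fin
import Data.Fin.Properties as FinP
open import Data.Bool using (Bool; true; false; _∧_; _∨_; not; if_then_else_)
import Data.Bool as Bool
open import Data.Bool.Properties using (not-involutive; ∨-zeroʳ)
open import Data.Product using (_×_; Σ; _,_; proj₁)
open import Data.Sum using (_⊎_; inj₁; inj₂)
open import Data.Empty using (⊥-elim)
open import Function using (_∘_)
open import Relation.Nullary using (¬_; Dec; does; yes; no)
open import Relation.Nullary.Decidable using (_×-dec_; _→-dec_; dec-true; dec-false)
open import Relation.Binary.PropositionalEquality using (_≡_; refl; sym; trans; cong; cong₂; subst)

sumFin-cong : ∀ n {f g : Fin n → ℕ} → (∀ i → f i ≡ g i) → sumFin n f ≡ sumFin n g
sumFin-cong zero    f≡g = refl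
sumFin-cong (suc n) f≡g = cong₂ _+_ (f≡g Fin.zero) (sumFin-cong n (f≡g ∘ Fin.suc))

sumFin-mono : ∀ n {f g : Fin n → ℕ} → (∀ i → f i ≤ g i) → sumFin n f ≤ sumFin n g
sumFin-mono zero    f≤g = z≤n
sumFin-mono (suc n) f≤g = ℕP.+-mono-≤ (f≤g Fin.zero) (sumFin-mono n (f≤g ∘ Fin.suc))

swap-sub-≤ : ∀ x q h → x - q ℤ.≤ h → x - h ℤ.≤ q
swap-sub-≤ x q h x-q≤h =
  ℤP.i-j≤0⇒i≤j (subst (ℤ._≤ ℤ.0ℤ) (exchange x q h) (ℤP.i≤j⇒i-j≤0 x-q≤h))
  where
  exchange : ∀ x q h → (x - q) - h ≡ (x - h) - q
  exchange = solve-∀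

module BoundedSearch {P : ℕ → Set} (P? : ∀ v → Dec (P v)) where

  NoneIn : ℕ → ℕ → Set
  NoneIn lo hi = ∀ v → lo ≤ v → v < hi → ¬ P v

  extend : ∀ {lo hi} → NoneIn lo hi → (lo ≤ hi → ¬ P hi) → NoneIn lo (suc hi)
  extend none ¬P-hi v lo≤v v<1+hi with ℕP.m<1+n⇒m<n∨m≡n v<1+hi
  ... | inj₁ v<hi = none v lo≤v v<hi
  ... | inj₂ refl = ¬P-hi lo≤v

  least : ∀ lo hi → NoneIn lo hi ⊎ Σ ℕ λ v → lo ≤ v × v < hi × P v × NoneIn lo v
  least lo zero = inj₁ λ _ _ ()
  least lo (suc hi) with least lo hi
  ... | inj₂ (v , lo≤v , v<hi , Pv , below) = inj₂ (v , lo≤v , ℕP.m<n⇒m<1+n v<hi , Pv , below)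
  ... | inj₁ none with lo ≤? hi ×-dec P? hi
  ...   | yes (lo≤hi , P-hi) = inj₂ (hi , lo≤hi , ℕP.n<1+n hi , P-hi , none)
  ...   | no ¬found = inj₁ (extend none λ lo≤hi P-hi → ¬found (lo≤hi , P-hi))

  greatest : ∀ lo hi → NoneIn lo hi ⊎ Σ ℕ λ v → lo ≤ v × v < hi × P v × NoneIn (suc v) hi
  greatest lo zero = inj₁ λ _ _ ()
  greatest lo (suc hi) with lo ≤? hi ×-dec P? hi
  ... | yes (lo≤hi , P-hi) =
    inj₂ (hi , lo≤hi , ℕP.n<1+n hi , P-hi , λ v hi<v v<1+hi → ⊥-elim (ℕP.<⇒≱ hi<v (ℕP.≤-pred v<1+hi)))
  ... | no ¬found with greatest lo hi
  ...   | inj₁ none = inj₁ (extend none λ lo≤hi P-hi → ¬found (lo≤hi , P-hi))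
  ...   | inj₂ (v , lo≤v , v<hi , Pv , above) =
    inj₂ (v , lo≤v , ℕP.m<n⇒m<1+n v<hi , Pv ,
          extend above λ v<hi′ P-hi → ¬found (ℕP.≤-trans lo≤v (ℕP.<⇒≤ v<hi′) , P-hi))

maximiser : ∀ n (R : Fin n → Set) → (∀ i → Dec (R i)) → (f : Fin n → ℕ) →
  (∀ i → ¬ R i) ⊎ (Σ (Fin n) λ i → R i × (∀ j → R j → f j ≤ f i))
maximiser zero R R? f = inj₁ λ ()
maximiser (suc n) R R? f with maximiser n (R ∘ Fin.suc) (R? ∘ Fin.suc) (f ∘ Fin.suc) | R? Fin.zero
... | inj₁ none | no ¬R0 = inj₁ λ { Fin.zero → ¬R0 ; (Fin.suc i) → none i }
... | inj₁ none | yes R0 =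
  inj₂ (Fin.zero , R0 , λ { Fin.zero _ → ℕP.≤-refl ; (Fin.suc j) Rj → ⊥-elim (none j Rj) })
... | inj₂ (i , Ri , max) | no ¬R0 =
  inj₂ (Fin.suc i , Ri , λ { Fin.zero R0 → ⊥-elim (¬R0 R0) ; (Fin.suc j) Rj → max j Rj })
... | inj₂ (i , Ri , max) | yes R0 with f (Fin.suc i) ≤? f Fin.zero
...   | yes fi≤f0 =
  inj₂ (Fin.zero , R0 , λ { Fin.zero _ → ℕP.≤-refl ; (Fin.suc j) Rj → ℕP.≤-trans (max j Rj) fi≤f0 })
...   | no fi≰f0 =
  inj₂ (Fin.suc i , Ri , λ { Fin.zero _ → ℕP.<⇒≤ (ℕP.≰⇒> fi≰f0) ; (Fin.suc j) Rj → max j Rj })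

module Resources (I : Instance) where
  open Instance I

  activeB-sound : ∀ i t → activeB I i t ≡ true → Active I i t
  activeB-sound i t act with s i ≤? t | t ≤? e i
  activeB-sound i t act  | yes s≤t | yes t≤e = s≤t , t≤e
  activeB-sound i t ()   | yes _   | no _
  activeB-sound i t ()   | no _    | _

  short-active⇒end : ∀ i t → short i ≡ true → activeB I i t ≡ true → e i ≡ t
  short-active⇒end i t sh act with activeB-sound i t act
  ... | s≤t , t≤e = ℕP.≤-antisym (subst (_≤ t) (short-single i sh) s≤t) t≤e

  long⇒not-short : ∀ i → isLong I i ≡ true → short i ≡ false
  long⇒not-short i long = trans (sym (not-involutive (short i))) (cong not long)

  short≢long : ∀ i j → short i ≡ true → isLong I j ≡ true → ¬ i ≡ j
  short≢long i j sh long refl with trans (sym sh) (long⇒not-short i long)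
  ... | ()

  Qsh-agree : ∀ S S′ t → (∀ i → short i ≡ true → activeB I i t ≡ true → S′ i ≡ S i) →
    Qsh I S′ t ≡ Qsh I S t
  Qsh-agree S S′ t agree = sumFin-cong m term
    where
    term : ∀ i → (if short i ∧ activeB I i t then S′ i * w i else 0)
               ≡ (if short i ∧ activeB I i t then S i * w i else 0)
    term i with short i in sh | activeB I i t in act
    ... | false | _     = refl
    ... | true  | false = refl
    ... | true  | true  = cong (_* w i) (agree i sh act)

  good-mono : ∀ {S S′} → Good I S → (∀ i → S′ i ≤ S i) → Good I S′
  good-mono good S′≤S t =
    ℕP.≤-trans (sumFin-mono m λ i → mono-if (short i ∧ activeB I i t) (S′≤S i)) (good t)
    where
    mono-if : ∀ c {x y} → x ≤ y → (if c then x else 0) ≤ (if c then y else 0)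
    mono-if true  x≤y = x≤y
    mono-if false x≤y = z≤n

  select : (Fin m → Bool) → Multiset I → Multiset I
  select keep S i = if keep i then S i else 0

  select-kept : ∀ keep S {i} → keep i ≡ true → select keep S i ≡ S i
  select-kept keep S kept rewrite kept = refl

  select-≤ : ∀ keep S i → select keep S i ≤ S i
  select-≤ keep S i with keep i
  ... | true  = ℕP.≤-refl
  ... | false = z≤n

  select-partition : ∀ keep S → Partition I S (select keep S) (select (not ∘ keep) S)
  select-partition keep S i with keep i
  ... | true  = ℕP.+-identityʳ (S i)
  ... | false = refl

  shortPart-onlyShort : ∀ S → OnlyShort I (shortPart I S)
  shortPart-onlyShort S i long rewrite long = refl

  Qsh-shortPart : ∀ S t → Qsh I (shortPart I S) t ≡ Qsh I S t
  Qsh-shortPart S t = Qsh-agree S (shortPart I S) t λ i sh _ → select-kept short S sh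

module Covers (I : Instance) (h : ℤ) (Q : ℕ → ℤ) where
  open Instance I
  open Resources I

  deficit : Multiset I → ℕ → ℤ
  deficit S t = Q t - + Qsh I S t

  Uncovered : Multiset I → ℕ → Set
  Uncovered S t = h ℤ.< deficit S t

  uncovered? : ∀ S t → Dec (Uncovered S t)
  uncovered? S t = h ℤ.<? deficit S t

  capacity : Multiset I → Fin m → ℕ
  capacity S i = w i * S i

  Supports : Multiset I → ℕ → Fin m → Set
  Supports S t i = isLong I i ≡ true × 1 ≤ S i × Active I i t

  supports? : ∀ S t i → Dec (Supports S t i)
  supports? S t i = (isLong I i Bool.≟ true) ×-dec ((1 ≤? S i) ×-dec ((s i ≤? t) ×-dec (t ≤? e i)))

  Strongest : Multiset I → ℕ → Fin m → Set
  Strongest S t X = ∀ j → Supports S t j → capacity S j ≤ capacity S X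

  strongest? : ∀ S X t → Dec (Strongest S t X)
  strongest? S X t = FinP.all? λ j → supports? S t j →-dec (capacity S j ≤? capacity S X)

  LongCover : Multiset I → ℕ → Set
  LongCover S t = Σ (Fin m) λ i → isLong I i ≡ true × 1 ≤ S i × Active I i t ×
                    deficit S t ℤ.≤ + (w i * S i)

  shortPart-cover : ∀ {lo hi S} → Good I S → (∀ t → lo ≤ t → t ≤ hi → ¬ Uncovered S t) →
    FreeCover I h lo hi Q (shortPart I S)
  shortPart-cover {S = S} good covered =
    shortPart-onlyShort S , good-mono good (select-≤ short S) ,
    λ t lo≤t t≤hi → subst (λ q → Q t - h ℤ.≤ + q) (sym (Qsh-shortPart S t))
                      (swap-sub-≤ (Q t) (+ Qsh I S t) h (ℤP.≮⇒≥ (covered t lo≤t t≤hi)))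

  StrongestSupport : Multiset I → ℕ → Set
  StrongestSupport S t = Σ (Fin m) λ Y → Supports S t Y × Strongest S t Y × deficit S t ℤ.≤ + capacity S Y

  strongest-support : ∀ {a b S t} → SLRACover I h a b Q S → a ≤ t → t ≤ b → Uncovered S t →
    StrongestSupport S t
  strongest-support {S = S} {t} (_ , cover) a≤t t≤b unc
    with cover t a≤t t≤b unc | maximiser m (Supports S t) (supports? S t) (capacity S)
  ... | (W , W-long , W-in , W-active , bound) | inj₁ none = ⊥-elim (none W (W-long , W-in , W-active))
  ... | (W , W-long , W-in , W-active , bound) | inj₂ (Y , Y-supports , Y-strongest) =
    Y , Y-supports , Y-strongest , ℤP.≤-trans bound (ℤ.+≤+ (Y-strongest W (W-long , W-in , W-active)))

  transfer : ∀ S S′ {t Y} → Qsh I S′ t ≡ Qsh I S t → S′ Y ≡ S Y → Supports S t Y →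
    deficit S t ℤ.≤ + capacity S Y → LongCover S′ t
  transfer S S′ {t} {Y} same-Qsh same-Y (Y-long , Y-in , Y-active) bound =
    Y , Y-long , subst (1 ≤_) (sym same-Y) Y-in , Y-active ,
    subst (λ q → Q t - + q ℤ.≤ + (w Y * S′ Y)) (sym same-Qsh)
      (subst (λ c → deficit S t ℤ.≤ + (w Y * c)) (sym same-Y) bound)

  uncovered-agree : ∀ S S′ {t} → Qsh I S′ t ≡ Qsh I S t → Uncovered S′ t → Uncovered S t
  uncovered-agree S S′ {t} same-Qsh = subst (λ q → h ℤ.< Q t - + q) same-Qsh

  IntervalCut : ℕ → ℕ → Multiset I → Set
  IntervalCut a b S = Σ (Fin m) λ X → isLong I X ≡ true × 1 ≤ S X ×
    FreeCover I h a (s X ∸ 1) Q (shortPart I S) × FreeCover I h (e X + 1) b Q (shortPart I S)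

  TimeCut : ℕ → ℕ → Multiset I → Set
  TimeCut a b S = Σ ℕ λ t → a ≤ t × t + 1 ≤ b ×
    Σ (Multiset I) λ S₁ → Σ (Multiset I) λ S₂ → Partition I S S₁ S₂ ×
      SLRACover I h a t Q S₁ × SLRACover I h (t + 1) b Q S₂

  interval-cut : ∀ {a b S} X → Good I S → isLong I X ≡ true → 1 ≤ S X →
    (∀ t → a ≤ t → t < s X → ¬ Uncovered S t) → (∀ t → e X < t → t ≤ b → ¬ Uncovered S t) →
    IntervalCut a b S
  interval-cut X good X-long X-in early late =
    X , X-long , X-in ,
    shortPart-cover good (λ t a≤t t≤sX-1 →
      early t a≤t (ℕP.m≤pred[n]⇒suc[m]≤n {{>-nonZero (proj₁ (interval-ok X))}} t≤sX-1)) ,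
    shortPart-cover good (λ t eX+1≤t → late t (subst (_≤ t) (ℕP.+-comm (e X) 1) eX+1≤t))

  module TimeCutAt {a b : ℕ} {S : Multiset I} (good : Good I S) (cover : SLRACover I h a b Q S)
      (X : Fin m) (X-long : isLong I X ≡ true) (X-in : 1 ≤ S X)
      (early : ∀ v → a ≤ v → v < s X → ¬ Uncovered S v)
      (t : ℕ) (a≤t : a ≤ t) (t<b : t < b) (t≤eX : t ≤ e X)
      (X-strongest : Strongest S t X) (X-last : ∀ v → t < v → v ≤ e X → ¬ Strongest S v X) where

    keep : Fin m → Bool
    keep i = does (e i ≤? t) ∨ does (i Fin.≟ X)

    keep-ended : ∀ {i} → e i ≤ t → keep i ≡ true
    keep-ended {i} eᵢ≤t = cong (_∨ does (i Fin.≟ X)) (dec-true (e i ≤? t) eᵢ≤t)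

    keep-X : keep X ≡ true
    keep-X = trans (cong (does (e X ≤? t) ∨_) (dec-true (X Fin.≟ X) refl)) (∨-zeroʳ _)

    drop-running : ∀ {i} → t < e i → ¬ i ≡ X → not (keep i) ≡ true
    drop-running {i} t<eᵢ i≢X =
      cong not (cong₂ _∨_ (dec-false (e i ≤? t) (ℕP.<⇒≱ t<eᵢ)) (dec-false (i Fin.≟ X) i≢X))

    S₁ S₂ : Multiset I
    S₁ = select keep S
    S₂ = select (not ∘ keep) S

    -- Short resources active at or before t end by t, so S₁ keeps them;
    -- those active after t end after t and are not X, so S₂ keeps them.
    Qsh₁ : ∀ {v} → v ≤ t → Qsh I S₁ v ≡ Qsh I S v
    Qsh₁ {v} v≤t = Qsh-agree S S₁ v λ i sh act →
      select-kept keep S (keep-ended (subst (_≤ t) (sym (short-active⇒end i v sh act)) v≤t))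

    Qsh₂ : ∀ {v} → t < v → Qsh I S₂ v ≡ Qsh I S v
    Qsh₂ {v} t<v = Qsh-agree S S₂ v λ i sh act →
      select-kept (not ∘ keep) S (drop-running (subst (t <_) (sym (short-active⇒end i v sh act)) t<v)
        (short≢long i X sh X-long))

    cover₁ : SLRACover I h a t Q S₁
    cover₁ = good-mono good (select-≤ keep S) , left
      where
      left : ∀ v → a ≤ v → v ≤ t → Uncovered S₁ v → LongCover S₁ v
      left v a≤v v≤t unc₁ = witness (strongest-support cover a≤v v≤b unc)
        where
        v≤b : v ≤ b
        v≤b = ℕP.≤-trans v≤t (ℕP.<⇒≤ t<b)
        unc : Uncovered S v
        unc = uncovered-agree S S₁ (Qsh₁ v≤t) unc₁
        X-active : Active I X v
        X-active = ℕP.≮⇒≥ (λ v<sX → early v a≤v v<sX unc) , ℕP.≤-trans v≤t t≤eX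
        -- A strongest witness Y ending by t is kept; otherwise Y is active at t,
        -- where X dominates it, and X is active at v.
        witness : StrongestSupport S v → LongCover S₁ v
        witness (Y , Y-supports@(Y-long , Y-in , sY≤v , v≤eY) , _ , bound) with e Y ≤? t
        ... | yes eY≤t = transfer S S₁ (Qsh₁ v≤t) (select-kept keep S (keep-ended eY≤t)) Y-supports bound
        ... | no eY≰t = transfer S S₁ (Qsh₁ v≤t) (select-kept keep S keep-X) (X-long , X-in , X-active)
          (ℤP.≤-trans bound (ℤ.+≤+ (X-strongest Y
            (Y-long , Y-in , ℕP.≤-trans sY≤v v≤t , ℕP.<⇒≤ (ℕP.≰⇒> eY≰t)))))

    cover₂ : SLRACover I h (t + 1) b Q S₂
    cover₂ = good-mono good (select-≤ (not ∘ keep) S) , right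
      where
      right : ∀ v → t + 1 ≤ v → v ≤ b → Uncovered S₂ v → LongCover S₂ v
      right v t+1≤v v≤b unc₂ = witness (strongest-support cover a≤v v≤b unc)
        where
        t<v : t < v
        t<v = subst (_≤ v) (ℕP.+-comm t 1) t+1≤v
        a≤v : a ≤ v
        a≤v = ℕP.≤-trans a≤t (ℕP.<⇒≤ t<v)
        unc : Uncovered S v
        unc = uncovered-agree S S₂ (Qsh₂ t<v) unc₂
        -- A strongest witness at v is not X (X is strongest at no slot after t),
        -- and it ends after t, so S₂ keeps it.
        witness : StrongestSupport S v → LongCover S₂ v
        witness (Y , Y-supports@(_ , _ , _ , v≤eY) , Y-strongest , bound) with Y Fin.≟ X
        ... | yes refl = ⊥-elim (X-last v t<v v≤eY Y-strongest)
        ... | no Y≢X = transfer S S₂ (Qsh₂ t<v)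
                         (select-kept (not ∘ keep) S (drop-running (ℕP.<-≤-trans t<v v≤eY) Y≢X))
                         Y-supports bound

    time-cut : TimeCut a b S
    time-cut = t , a≤t , subst (_≤ b) (ℕP.+-comm 1 t) t<b ,
               S₁ , S₂ , select-partition keep S , cover₁ , cover₂

  cut-around : ∀ {a b S} → Good I S → SLRACover I h a b Q S →
    ∀ X → isLong I X ≡ true → 1 ≤ S X → (∀ v → a ≤ v → v < s X → ¬ Uncovered S v) →
    ∀ t₀ → a ≤ t₀ → t₀ ≤ e X → Strongest S t₀ X → TimeCut a b S ⊎ IntervalCut a b S
  cut-around {b = b} {S = S} good cover X X-long X-in early t₀ a≤t₀ t₀≤eX X-strongest₀
    with BoundedSearch.greatest (strongest? S X) t₀ (suc (e X))
  ... | inj₁ none = ⊥-elim (none t₀ ℕP.≤-refl (s≤s t₀≤eX) X-strongest₀)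
  ... | inj₂ (t , t₀≤t , t<1+eX , X-strongest , X-last)
    with BoundedSearch.least (uncovered? S) (suc t) (suc b)
  ... | inj₂ (u , t<u , u<1+b , _ , _) =
    inj₁ (TimeCutAt.time-cut good cover X X-long X-in early
            t (ℕP.≤-trans a≤t₀ t₀≤t) (ℕP.<-≤-trans t<u (ℕP.≤-pred u<1+b)) (ℕP.≤-pred t<1+eX)
            X-strongest λ v t<v v≤eX → X-last v t<v (s≤s v≤eX))
  ... | inj₁ none =
    inj₂ (interval-cut X good X-long X-in early λ v eX<v v≤b →
            none v (ℕP.≤-<-trans (ℕP.≤-pred t<1+eX) eX<v) (s≤s v≤b))

  trichotomy : ∀ {a b S} → Good I S → SLRACover I h a b Q S →
    FreeCover I h a b Q (shortPart I S) ⊎ TimeCut a b S ⊎ IntervalCut a b S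
  trichotomy {a} {b} {S} good cover with BoundedSearch.least (uncovered? S) a (suc b)
  ... | inj₁ none = inj₁ (shortPart-cover good λ v a≤v v≤b → none v a≤v (s≤s v≤b))
  ... | inj₂ (t₀ , a≤t₀ , t₀<1+b , unc₀ , first)
    with strongest-support cover a≤t₀ (ℕP.≤-pred t₀<1+b) unc₀
  ... | X , (X-long , X-in , sX≤t₀ , t₀≤eX) , X-strongest₀ , _ =
    inj₂ (cut-around good cover X X-long X-in
            (λ v a≤v v<sX → first v a≤v (ℕP.<-≤-trans v<sX sX≤t₀)) t₀ a≤t₀ t₀≤eX X-strongest₀)

lemma4 : (I : Instance) → (a b : ℕ) → 1 ≤ a → a ≤ b → b ≤ Instance.T I →
    (Q : ℕ → ℤ) → IsProfile I a b Q → (h : ℤ) → (S : Multiset I) →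
    Good I S → SLRACover I h a b Q S →
    FreeCover I h a b Q (shortPart I S)
    ⊎ (Σ ℕ λ tstar → a ≤ tstar × tstar + 1 ≤ b ×
         Σ (Multiset I) λ S1 → Σ (Multiset I) λ S2 → Partition I S S1 S2 ×
           SLRACover I h a tstar Q S1 × SLRACover I h (tstar + 1) b Q S2)
    ⊎ (Σ (Fin (Instance.m I)) λ istar → isLong I istar ≡ true × 1 ≤ S istar ×
         FreeCover I h a (Instance.s I istar ∸ 1) Q (shortPart I S) ×
         FreeCover I h (Instance.e I istar + 1) b Q (shortPart I S))
lemma4 I a b _ _ _ Q _ h S good cover = Covers.trichotomy I h Q good cover
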